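{- Let $k\ge1$ and let $n$ be a power of $2$. If $\mathcal D$ is a linear $(n,\,n2^k,\,n2^{k-2})^*$-code in $Z_{2^k}^n$, then $\mathcal D$ contains an element of $\{1,3,\dots,2^k-1\}^n$.
   Context: With $m=2^{k-1}$: $wt^*(0)=0$, $wt^*(m)=m$, $wt^*(x)=m/2$ otherwise on $Z_{2^k}$, $d^*(\bar x,\bar y)=\sum_iwt^*(y_i-x_i)$; an $(n,M,d)^*$-code is a subset of $Z_{2^k}^n$ of size $M$ with pairwise $d^*$-distance at least $d$. Linear means a $Z_{2^k}$-submodule. -}

module Defs where

open import Data.Nat using (ℕ; zero; suc; _+_; _*_; _∸_; _^_; _≤_; _≟_; NonZero)
open import Data.Nat.Properties using (m^n≢0)
open import Data.Nat.DivMod using (_%_; m%n<n)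
open import Data.Fin using (Fin; toℕ; fromℕ<)
open import Data.Vec using (Vec; zipWith; map; replicate; foldr)
open import Data.List using (List; length)
open import Data.List.Membership.Propositional using (_∈_)
open import Data.List.Relation.Unary.Unique.Propositional using (Unique)
open import Data.Vec.Relation.Unary.All using (All)
open import Data.Product using (Σ; ∃; _×_)
open import Relation.Binary.PropositionalEquality using (_≡_; _≢_)
open import Relation.Nullary using (yes; no)

Zq : ℕ → Set
Zq k = Fin (2 ^ k)

module _ (k : ℕ) where
  private
    q : ℕ
    q = 2 ^ k
    instance
      q≢0 : NonZero q
      q≢0 = m^n≢0 2 k

  red : ℕ → Zq k
  red a = fromℕ< (m%n<n a q)

  zeroZ : Zq k
  zeroZ = red 0

  addZ : Zq k → Zq k → Zq k
  addZ x y = red (toℕ x + toℕ y)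

  mulZ : Zq k → Zq k → Zq k
  mulZ x y = red (toℕ x * toℕ y)

  subZ : Zq k → Zq k → Zq k
  subZ y x = red (toℕ y + (q ∸ toℕ x))

-- m = 2^(k-1).  Twice the weight wt*:  2 wt*(0) = 0, 2 wt*(m) = 2m, 2 wt*(x) = m otherwise.
-- (We work with doubled weights since wt*(x) = m/2 need not be an integer when k = 1.)
wt2 : (k : ℕ) → Zq k → ℕ
wt2 k x with toℕ x ≟ 0
... | yes _ = 0
... | no _ with toℕ x ≟ 2 ^ (k ∸ 1)
...   | yes _ = 2 * 2 ^ (k ∸ 1)
...   | no _ = 2 ^ (k ∸ 1)

dist2 : (k n : ℕ) → Vec (Zq k) n → Vec (Zq k) n → ℕ
dist2 k n x y = foldr _ _+_ 0 (map (wt2 k) (zipWith (subZ k) y x))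

-- A code in Z_{2^k}^n, given as a duplicate-free list of codewords.
Code : ℕ → ℕ → Set
Code k n = List (Vec (Zq k) n)

-- D is an (n, M, d)*-code, with the minimum distance given doubled: d2 = 2 d.
IsCode* : (k n M d2 : ℕ) → Code k n → Set
IsCode* k n M d2 D =
  Unique D × length D ≡ M ×
  (∀ x y → x ∈ D → y ∈ D → x ≢ y → d2 ≤ dist2 k n x y)

IsLinear : (k n : ℕ) → Code k n → Set
IsLinear k n D =
  replicate n (zeroZ k) ∈ D ×
  (∀ x y → x ∈ D → y ∈ D → zipWith (addZ k) x y ∈ D) ×
  (∀ (a : Zq k) x → x ∈ D → map (mulZ k a) x ∈ D)

Odd : ℕ → Set
Odd a = a Data.Nat.% 2 ≡ 1

IsPowerOf2 : ℕ → Set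
IsPowerOf2 n = ∃ λ t → n ≡ 2 ^ t

-- Write m = 2^(k-1) and let W be twice the weight wt*, so W adds up the values 0, 2m and m of a
-- coordinate equal to 0, to m, or to anything else, and a nonzero codeword has nm ≤ W ≤ 2nm.
-- Translating by a codeword permutes D, and translating by a codeword with entry m in a coordinate
-- turns the weight w there into 2m - w. A first-moment (Plotkin) count then shows that m occurs in
-- every coordinate and that the total weight of D is nm|D|. Expanding the second moment ΣW² over
-- pairs of coordinates bounds it from below, while (W - nm)(W - 2nm) ≤ 0 bounds it from above by
-- the same quantity. Equality forces every nonzero weight to be nm or 2nm and limits how often a
-- coordinate can be 0 or m, which in turn forces an odd entry into every coordinate; so in every
-- coordinate exactly half of the codewords are odd. Finally 2^(k-1)x ∈ D has weight 2m times the
-- number of odd coordinates of x, so each codeword has 0, n/2 or n odd coordinates; were n never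
-- attained, the zero codeword would pull the average number below n/2.

module Submission where

open import Defs
open import Data.Empty using (⊥; ⊥-elim)
open import Data.Fin as Fin using (Fin; toℕ; zero; suc)
open import Data.Fin.Properties using (toℕ-fromℕ<; toℕ-injective; toℕ<n)
open import Data.List as List using (List; []; _∷_; _++_; length; upTo; allFin)
open import Data.List.Properties using (length-map; map-tabulate; length-tabulate; length-upTo)
open import Data.List.Membership.Propositional using (_∈_; find; lose)
open import Data.List.Membership.Propositional.Properties using (∈-∃++; ∈-map⁻; ∈-map⁺; ∈-upTo⁺; ∈-allFin)
open import Data.List.Relation.Binary.Permutation.Propositional using (_↭_; ↭-refl; ↭-sym; ↭-trans; ↭-prep; ↭⇒↭ₛ)
import Data.List.Relation.Binary.Permutation.Propositional.Properties as ↭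
import Data.List.Relation.Binary.Permutation.Setoid.Properties as Setoid↭
open import Data.List.Relation.Binary.Subset.Propositional using (_⊆_)
import Data.List.Relation.Unary.All as ListAll
open import Data.List.Relation.Unary.AllPairs using (_∷_)
open import Data.List.Relation.Unary.Any using (here; there; any?)
open import Data.List.Relation.Unary.Unique.Propositional using (Unique)
import Data.List.Relation.Unary.Unique.Propositional.Properties as Unique
open import Data.Nat
open import Data.Nat.DivMod
open import Data.Nat.Divisibility using (divides)
open import Data.Nat.ListAction using (sum)
open import Data.Nat.ListAction.Properties using (sum-↭)
open import Data.Nat.Properties
open import Algebra.Properties.CommutativeSemigroup +-commutativeSemigroup using (interchange; xy∙z≈xz∙y)
open import Algebra.Properties.CommutativeSemigroup *-commutativeSemigroup using (x∙yz≈y∙xz)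
open import Data.Nat.Tactic.RingSolver using (solve-∀)
open import Data.Product using (∃; _×_; _,_)
open import Data.Sum using (_⊎_; inj₁; inj₂)
open import Data.Vec using (Vec; []; _∷_; lookup; zipWith; map; replicate; tabulate)
open import Data.Vec.Properties using (lookup-zipWith; lookup-map; lookup-replicate; tabulate∘lookup; tabulate-cong; ≡-dec)
open import Data.Vec.Relation.Unary.All using (All; all?)
open import Data.Vec.Relation.Unary.All.Properties using (lookup⁻)
open import Function using (_∘_)
open import Relation.Binary.Definitions using (DecidableEquality)
open import Relation.Binary.PropositionalEquality
open import Relation.Nullary using (Dec; yes; no; ¬_; _×-dec_)

-- Arithmetic on ℕ

m+m≡n+n⇒m≡n : ∀ {m n} → m + m ≡ n + n → m ≡ n
m+m≡n+n⇒m≡n {m} {n} m+m≡n+n = trans (n≡⌊n+n/2⌋ m) (trans (cong ⌊_/2⌋ m+m≡n+n) (sym (n≡⌊n+n/2⌋ n)))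

%2≡0⊎%2≡1 : ∀ x → x % 2 ≡ 0 ⊎ x % 2 ≡ 1
%2≡0⊎%2≡1 x with x % 2 | m%n<n x 2
... | 0 | _ = inj₁ refl
... | 1 | _ = inj₂ refl
... | suc (suc _) | s≤s (s≤s ())

*-%-absorbʳ : ∀ c x d .{{_ : NonZero d}} → (c * (x % d)) % d ≡ (c * x) % d
*-%-absorbʳ c x d = begin
  (c * (x % d)) % d            ≡⟨ %-distribˡ-* c (x % d) d ⟩
  (c % d * (x % d % d)) % d    ≡⟨ cong (λ t → (c % d * t) % d) (m%n%n≡m%n x d) ⟩
  (c % d * (x % d)) % d        ≡⟨ %-distribˡ-* c x d ⟨
  (c * x) % d                  ∎
  where open ≡-Reasoning

[A+u]²+2A²≡3A²+2Au+u² : ∀ A u → (A + u) * (A + u) + (A * A + A * A) ≡ 3 * A * A + 2 * A * u + u * u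
[A+u]²+2A²≡3A²+2Au+u² = solve-∀

3A[A+u]≡3A²+2Au+Au : ∀ A u → 3 * A * (A + u) ≡ 3 * A * A + 2 * A * u + A * u
3A[A+u]≡3A²+2Au+Au = solve-∀

A≤W≤2A⇒W²+2A²≤3AW : ∀ {A W} → A ≤ W → W ≤ A + A → W * W + (A * A + A * A) ≤ 3 * A * W
A≤W≤2A⇒W²+2A²≤3AW {A} {W} A≤W W≤2A with W ∸ A | m+[n∸m]≡n A≤W
... | u | refl = subst₂ _≤_ (sym ([A+u]²+2A²≡3A²+2Au+u² A u)) (sym (3A[A+u]≡3A²+2Au+Au A u))
  (+-monoʳ-≤ (3 * A * A + 2 * A * u) (*-monoˡ-≤ u (+-cancelˡ-≤ A u A W≤2A)))

W²+2A²≡3AW⇒W≡A⊎W≡2A : ∀ {A W} → A ≤ W → W * W + (A * A + A * A) ≡ 3 * A * W → W ≡ A ⊎ W ≡ A + A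
W²+2A²≡3AW⇒W≡A⊎W≡2A {A} {W} A≤W eq with W ∸ A | m+[n∸m]≡n A≤W
... | u | refl = u≡0⊎u≡A u (+-cancelˡ-≡ (3 * A * A + 2 * A * u) (u * u) (A * u)
  (trans (sym ([A+u]²+2A²≡3A²+2Au+u² A u)) (trans eq (3A[A+u]≡3A²+2Au+Au A u))))
  where
  u≡0⊎u≡A : ∀ u → u * u ≡ A * u → A + u ≡ A ⊎ A + u ≡ A + A
  u≡0⊎u≡A zero _ = inj₁ (+-identityʳ A)
  u≡0⊎u≡A (suc u) u²≡Au = inj₂ (cong (A +_) (*-cancelʳ-≡ (suc u) A (suc u) u²≡Au))

first-moment-contradiction : ∀ {N n m S} → N ≡ n * (m + m) → 1 ≤ n → 1 ≤ m →
                             N * (n * m) ≤ S + n * m → S + N * m ≤ n * (N * m) → ⊥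
first-moment-contradiction {N} {n} {m} {S} N≡ 1≤n 1≤m lower upper = <⇒≱ n<N N≤n
  where
  open ≤-Reasoning
  instance
    m-nonZero : NonZero m
    m-nonZero = >-nonZero 1≤m
  N*m≤n*m : N * (n * m) + N * m ≤ N * (n * m) + n * m
  N*m≤n*m = begin
    N * (n * m) + N * m  ≤⟨ +-monoˡ-≤ (N * m) lower ⟩
    S + n * m + N * m    ≡⟨ xy∙z≈xz∙y S (n * m) (N * m) ⟩
    S + N * m + n * m    ≤⟨ +-monoˡ-≤ (n * m) upper ⟩
    n * (N * m) + n * m  ≡⟨ cong (_+ n * m) (x∙yz≈y∙xz n N m) ⟩
    N * (n * m) + n * m  ∎
  N≤n : N ≤ n
  N≤n = *-cancelʳ-≤ N n m (+-cancelˡ-≤ (N * (n * m)) (N * m) (n * m) N*m≤n*m)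
  n<N : n < N
  n<N = begin-strict
    n            <⟨ m<m+n n 1≤n ⟩
    n + n        ≤⟨ +-mono-≤ (m≤m*n n m) (m≤m*n n m) ⟩
    n * m + n * m ≡⟨ *-distribˡ-+ n m m ⟨
    n * (m + m)  ≡⟨ N≡ ⟨
    N            ∎

even<2m⇒∈doubles : ∀ {x m} → x % 2 ≡ 0 → x < 2 * m → x ∈ List.map (2 *_) (upTo m)
even<2m⇒∈doubles {x} {m} x-even x<2m = subst (_∈ List.map (2 *_) (upTo m)) (sym x≡2*[x/2])
  (∈-map⁺ (2 *_) (∈-upTo⁺ (m<n*o⇒m/o<n (subst (x <_) (*-comm 2 m) x<2m))))
  where
  x≡2*[x/2] : x ≡ 2 * (x / 2)
  x≡2*[x/2] = trans (m≡m%n+[m/n]*n x 2) (trans (cong (_+ x / 2 * 2) x-even) (*-comm (x / 2) 2))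

last-nonzero : ∀ (f : ℕ → ℕ) n → f 0 ≢ 0 → f n ≡ 0 → ∃ λ t → f t ≢ 0 × f (suc t) ≡ 0
last-nonzero f zero    f0≢0 fn≡0 = ⊥-elim (f0≢0 fn≡0)
last-nonzero f (suc n) f0≢0 f1+n≡0 with f n ≟ 0
... | yes fn≡0 = last-nonzero f n f0≢0 fn≡0
... | no fn≢0  = n , fn≢0 , f1+n≡0

-- Indicators and finite sums

𝟙 : ∀ {P : Set} → Dec P → ℕ
𝟙 (yes _) = 1
𝟙 (no _) = 0

𝟙-yes : ∀ {P : Set} (d : Dec P) → P → 𝟙 d ≡ 1
𝟙-yes (yes _) _ = refl
𝟙-yes (no ¬p) p = ⊥-elim (¬p p)

𝟙-no : ∀ {P : Set} (d : Dec P) → ¬ P → 𝟙 d ≡ 0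
𝟙-no (yes p) ¬p = ⊥-elim (¬p p)
𝟙-no (no _) _ = refl

𝟙-cong : ∀ {P Q : Set} (d : Dec P) (e : Dec Q) → (P → Q) → (Q → P) → 𝟙 d ≡ 𝟙 e
𝟙-cong (yes _) (yes _) _ _ = refl
𝟙-cong (yes p) (no ¬q) p⇒q _ = ⊥-elim (¬q (p⇒q p))
𝟙-cong (no ¬p) (yes q) _ q⇒p = ⊥-elim (¬p (q⇒p q))
𝟙-cong (no _) (no _) _ _ = refl

∑ : ∀ {A : Set} → List A → (A → ℕ) → ℕ
∑ xs f = sum (List.map f xs)

syntax ∑ xs (λ x → e) = ∑[ x ∈ xs ] e

∑-map : ∀ {A B : Set} (g : A → B) (f : B → ℕ) xs → ∑[ y ∈ List.map g xs ] f y ≡ ∑[ x ∈ xs ] f (g x)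
∑-map g f [] = refl
∑-map g f (x ∷ xs) = cong (f (g x) +_) (∑-map g f xs)

module _ {A : Set} where

  unique-resp-↭ : ∀ {xs ys : List A} → xs ↭ ys → Unique xs → Unique ys
  unique-resp-↭ p = Setoid↭.Unique-resp-↭ (setoid A) (↭⇒↭ₛ p)

  ⊆∧length⇒↭ : ∀ {xs ys : List A} → Unique xs → Unique ys → xs ⊆ ys →
               length xs ≡ length ys → xs ↭ ys
  ⊆∧length⇒↭ {[]} {[]} _ _ _ _ = ↭-refl
  ⊆∧length⇒↭ {x ∷ xs} (x∉xs ∷ xs!) ys! xs⊆ys len with ∈-∃++ (xs⊆ys (here refl))
  ... | ys₁ , ys₂ , refl =
    ↭-trans (↭-prep x (⊆∧length⇒↭ xs! ys′! xs⊆ys′ (suc-injective (trans len (↭.↭-length σ))))) (↭-sym σ)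
    where
    σ : ys₁ ++ x ∷ ys₂ ↭ x ∷ ys₁ ++ ys₂
    σ = ↭.shift x ys₁ ys₂
    ys′! : Unique (ys₁ ++ ys₂)
    ys′! with unique-resp-↭ σ ys!
    ... | _ ∷ u = u
    xs⊆ys′ : xs ⊆ ys₁ ++ ys₂
    xs⊆ys′ {z} z∈xs with ↭.∈-resp-↭ σ (xs⊆ys (there z∈xs))
    ... | here refl = ⊥-elim (ListAll.lookup x∉xs z∈xs refl)
    ... | there z∈ys′ = z∈ys′

  ∑-+ : ∀ (f g : A → ℕ) xs → ∑[ x ∈ xs ] (f x + g x) ≡ ∑[ x ∈ xs ] f x + ∑[ x ∈ xs ] g x
  ∑-+ f g [] = refl
  ∑-+ f g (x ∷ xs) rewrite ∑-+ f g xs = interchange (f x) (g x) (∑ xs f) (∑ xs g)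

  ∑-*ˡ : ∀ c (f : A → ℕ) xs → ∑[ x ∈ xs ] (c * f x) ≡ c * ∑[ x ∈ xs ] f x
  ∑-*ˡ c f [] = sym (*-zeroʳ c)
  ∑-*ˡ c f (x ∷ xs) rewrite ∑-*ˡ c f xs = sym (*-distribˡ-+ c (f x) _)

  ∑-const : ∀ c (xs : List A) → ∑[ x ∈ xs ] c ≡ length xs * c
  ∑-const c [] = refl
  ∑-const c (x ∷ xs) = cong (c +_) (∑-const c xs)

  ∑-cong : ∀ {f g : A → ℕ} xs → (∀ {x} → x ∈ xs → f x ≡ g x) → ∑ xs f ≡ ∑ xs g
  ∑-cong [] _ = refl
  ∑-cong (x ∷ xs) f≡g = cong₂ _+_ (f≡g (here refl)) (∑-cong xs (f≡g ∘ there))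

  ∑-zero : ∀ (f : A → ℕ) xs → (∀ {x} → x ∈ xs → f x ≡ 0) → ∑ xs f ≡ 0
  ∑-zero f xs f≡0 = trans (∑-cong xs f≡0) (trans (∑-const 0 xs) (*-zeroʳ (length xs)))

  ∑-mono-≤ : ∀ {f g : A → ℕ} xs → (∀ {x} → x ∈ xs → f x ≤ g x) → ∑ xs f ≤ ∑ xs g
  ∑-mono-≤ [] _ = z≤n
  ∑-mono-≤ (x ∷ xs) f≤g = +-mono-≤ (f≤g (here refl)) (∑-mono-≤ xs (f≤g ∘ there))

  ∑-squeeze : ∀ {f g : A → ℕ} xs → (∀ {x} → x ∈ xs → f x ≤ g x) → ∑ xs g ≤ ∑ xs f →
              ∀ {x} → x ∈ xs → f x ≡ g x
  ∑-squeeze {f} {g} (y ∷ xs) f≤g ∑g≤∑f (here refl) =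
    ≤-antisym (f≤g (here refl))
      (+-cancelʳ-≤ (∑ xs f) (g y) (f y) (≤-trans (+-monoʳ-≤ (g y) (∑-mono-≤ xs (f≤g ∘ there))) ∑g≤∑f))
  ∑-squeeze {f} {g} (y ∷ xs) f≤g ∑g≤∑f (there x∈xs) =
    ∑-squeeze xs (f≤g ∘ there)
      (+-cancelˡ-≤ (f y) (∑ xs g) (∑ xs f) (≤-trans (+-monoˡ-≤ (∑ xs g) (f≤g (here refl))) ∑g≤∑f)) x∈xs

  length*c+d≤∑ : ∀ (f : A → ℕ) c d {xs x} → x ∈ xs → (∀ {y} → y ∈ xs → c ≤ f y) → c + d ≤ f x →
                 length xs * c + d ≤ ∑ xs f
  length*c+d≤∑ f c d {_ ∷ xs} (here refl) c≤f c+d≤fx = begin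
    c + length xs * c + d  ≡⟨ xy∙z≈xz∙y c _ d ⟩
    c + d + length xs * c  ≤⟨ +-mono-≤ c+d≤fx (≤-trans (≤-reflexive (sym (∑-const c xs))) (∑-mono-≤ xs (c≤f ∘ there))) ⟩
    f _ + ∑ xs f           ∎
    where open ≤-Reasoning
  length*c+d≤∑ f c d {y ∷ xs} (there x∈xs) c≤f c+d≤fx =
    ≤-trans (≤-reflexive (+-assoc c _ d)) (+-mono-≤ (c≤f (here refl)) (length*c+d≤∑ f c d x∈xs (c≤f ∘ there) c+d≤fx))

  ∑+d≤length*c : ∀ (f : A → ℕ) c d {xs x} → x ∈ xs → (∀ {y} → y ∈ xs → f y ≤ c) → f x + d ≤ c →
                 ∑ xs f + d ≤ length xs * c
  ∑+d≤length*c f c d {_ ∷ xs} (here refl) f≤c fx+d≤c = begin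
    f _ + ∑ xs f + d       ≡⟨ xy∙z≈xz∙y (f _) _ d ⟩
    f _ + d + ∑ xs f       ≤⟨ +-mono-≤ fx+d≤c (≤-trans (∑-mono-≤ xs (f≤c ∘ there)) (≤-reflexive (∑-const c xs))) ⟩
    c + length xs * c      ∎
    where open ≤-Reasoning
  ∑+d≤length*c f c d {y ∷ xs} (there x∈xs) f≤c fx+d≤c =
    ≤-trans (≤-reflexive (+-assoc (f y) _ d)) (+-mono-≤ (f≤c (here refl)) (∑+d≤length*c f c d x∈xs (f≤c ∘ there) fx+d≤c))

  ∑-↭ : ∀ (f : A → ℕ) {xs ys} → xs ↭ ys → ∑ xs f ≡ ∑ ys f
  ∑-↭ f p = sum-↭ (↭.map⁺ f p)

  ∑-𝟙-≟ : (_≟_ : DecidableEquality A) → ∀ {xs a} → Unique xs → a ∈ xs → ∑[ x ∈ xs ] 𝟙 (x ≟ a) ≡ 1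
  ∑-𝟙-≟ _≟_ {x ∷ xs} (x∉xs ∷ xs!) (here refl) with x ≟ x
  ... | yes _ = cong suc (∑-zero _ xs 𝟙≡0)
    where
    𝟙≡0 : ∀ {y} → y ∈ xs → 𝟙 (y ≟ x) ≡ 0
    𝟙≡0 {y} y∈xs with y ≟ x
    ... | yes refl = ⊥-elim (ListAll.lookup x∉xs y∈xs refl)
    ... | no _ = refl
  ... | no x≢x = ⊥-elim (x≢x refl)
  ∑-𝟙-≟ _≟_ {x ∷ xs} {a} (x∉xs ∷ xs!) (there a∈xs) with x ≟ a
  ... | yes refl = ⊥-elim (ListAll.lookup x∉xs a∈xs refl)
  ... | no _ = ∑-𝟙-≟ _≟_ xs! a∈xs

  ∑-square : ∀ (f : A → ℕ) xs → ∑ xs f * ∑ xs f ≡ ∑[ x ∈ xs ] ∑[ y ∈ xs ] (f x * f y)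
  ∑-square f xs = trans (sym (∑-*ˡ (∑ xs f) f xs))
    (∑-cong xs (λ {x} _ → trans (*-comm (∑ xs f) (f x)) (sym (∑-*ˡ (f x) f xs))))

  ∑-∘-injective : ∀ (f : A → ℕ) {g : A → A} {xs} → Unique xs → (∀ {x y} → g x ≡ g y → x ≡ y) →
                  (∀ {x} → x ∈ xs → g x ∈ xs) → ∑[ x ∈ xs ] f (g x) ≡ ∑ xs f
  ∑-∘-injective f {g} {xs} xs! g-inj g-closed = trans (sym (∑-map g f xs))
    (∑-↭ f (⊆∧length⇒↭ (Unique.map⁺ g-inj xs!) xs! gxs⊆xs (length-map g xs)))
    where
    gxs⊆xs : List.map g xs ⊆ xs
    gxs⊆xs y∈gxs with ∈-map⁻ g y∈gxs
    ... | x , x∈xs , refl = g-closed x∈xs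

∑-swap : ∀ {A B : Set} (f : A → B → ℕ) xs ys → ∑[ x ∈ xs ] ∑[ y ∈ ys ] f x y ≡ ∑[ y ∈ ys ] ∑[ x ∈ xs ] f x y
∑-swap f [] ys = sym (∑-zero _ ys (λ _ → refl))
∑-swap f (x ∷ xs) ys = trans (cong (∑ ys (f x) +_) (∑-swap f xs ys)) (sym (∑-+ (f x) _ ys))

∑-allFin-suc : ∀ {n} (f : Fin (suc n) → ℕ) → ∑ (allFin (suc n)) f ≡ f zero + ∑[ i ∈ allFin n ] f (suc i)
∑-allFin-suc {n} f = cong (f zero +_) (trans (cong (λ is → ∑ is f) (sym (map-tabulate {n = n} (λ i → i) suc))) (∑-map suc f (allFin n)))

length-allFin : ∀ n → length (allFin n) ≡ n
length-allFin n = length-tabulate {n = n} (λ i → i)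

∑-allFin-const : ∀ n c → ∑[ i ∈ allFin n ] c ≡ n * c
∑-allFin-const n c = trans (∑-const c (allFin n)) (cong (_* c) (length-allFin n))

-- The ring Z_(2^(k+1)): the paper's k is suc k here, so m = 2^k is its 2^(k-1), and q = 2m.

module Residues (k : ℕ) where

  m q : ℕ
  m = 2 ^ k
  q = 2 ^ suc k

  Z : Set
  Z = Zq (suc k)

  instance
    m-nonZero : NonZero m
    m-nonZero = m^n≢0 2 k
    q-nonZero : NonZero q
    q-nonZero = m^n≢0 2 (suc k)

  q≡m+m : q ≡ m + m
  q≡m+m = cong (m +_) (+-identityʳ m)

  0<m : 0 < m
  0<m = m^n>0 2 k

  m≢0 : m ≢ 0
  m≢0 = ≢-nonZero⁻¹ m

  q*[N*m]≡N*[m*m]+N*[m*m] : ∀ N → q * (N * m) ≡ N * (m * m) + N * (m * m)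
  q*[N*m]≡N*[m*m]+N*[m*m] N = 2m*[N*m]≡N*[m*m]+N*[m*m] m N
    where
    2m*[N*m]≡N*[m*m]+N*[m*m] : ∀ m N → 2 * m * (N * m) ≡ N * (m * m) + N * (m * m)
    2m*[N*m]≡N*[m*m]+N*[m*m] = solve-∀

  m<q : m < q
  m<q = subst (m <_) (sym q≡m+m) (m<m+n m 0<m)

  infixl 6 _+ᶻ_

  _+ᶻ_ : Z → Z → Z
  _+ᶻ_ = addZ (suc k)

  0ᶻ mᶻ : Z
  0ᶻ = zeroZ (suc k)
  mᶻ = red (suc k) m

  toℕ-red : ∀ a → toℕ (red (suc k) a) ≡ a % q
  toℕ-red a = toℕ-fromℕ< (m%n<n a q)

  toℕ-+ᶻ : ∀ a b → toℕ (a +ᶻ b) ≡ (toℕ a + toℕ b) % q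
  toℕ-+ᶻ a b = toℕ-red (toℕ a + toℕ b)

  toℕ-0ᶻ : toℕ 0ᶻ ≡ 0
  toℕ-0ᶻ = trans (toℕ-red 0) (m<n⇒m%n≡m (m^n>0 2 (suc k)))

  toℕ-mᶻ : toℕ mᶻ ≡ m
  toℕ-mᶻ = trans (toℕ-red m) (m<n⇒m%n≡m m<q)

  +ᶻ-identityˡ : ∀ {c} a → toℕ c ≡ 0 → c +ᶻ a ≡ a
  +ᶻ-identityˡ a c≡0 = toℕ-injective (begin
    toℕ (_ +ᶻ a)     ≡⟨ toℕ-+ᶻ _ a ⟩
    (toℕ _ + toℕ a) % q  ≡⟨ cong (λ t → (t + toℕ a) % q) c≡0 ⟩
    toℕ a % q        ≡⟨ m<n⇒m%n≡m (toℕ<n a) ⟩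
    toℕ a            ∎)
    where open ≡-Reasoning

  +ᶻ-identityʳ : ∀ {c} a → toℕ c ≡ 0 → a +ᶻ c ≡ a
  +ᶻ-identityʳ {c} a c≡0 = toℕ-injective (begin
    toℕ (a +ᶻ c)     ≡⟨ toℕ-+ᶻ a c ⟩
    (toℕ a + toℕ c) % q  ≡⟨ cong (λ t → (toℕ a + t) % q) c≡0 ⟩
    (toℕ a + 0) % q  ≡⟨ cong (_% q) (+-identityʳ (toℕ a)) ⟩
    toℕ a % q        ≡⟨ m<n⇒m%n≡m (toℕ<n a) ⟩
    toℕ a            ∎)
    where open ≡-Reasoning

  +ᶻ-cancelʳ : ∀ {a b} c → a +ᶻ c ≡ b +ᶻ c → a ≡ b
  +ᶻ-cancelʳ {a} {b} c a+c≡b+c = toℕ-injective (begin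
    toℕ a                              ≡⟨ undo a ⟨
    ((toℕ a + toℕ c) % q + (q ∸ toℕ c)) % q ≡⟨ cong (λ t → (t + (q ∸ toℕ c)) % q) ac≡bc ⟩
    ((toℕ b + toℕ c) % q + (q ∸ toℕ c)) % q ≡⟨ undo b ⟩
    toℕ b                              ∎)
    where
    open ≡-Reasoning
    ac≡bc : (toℕ a + toℕ c) % q ≡ (toℕ b + toℕ c) % q
    ac≡bc = trans (sym (toℕ-+ᶻ a c)) (trans (cong toℕ a+c≡b+c) (toℕ-+ᶻ b c))
    undo : ∀ z → ((toℕ z + toℕ c) % q + (q ∸ toℕ c)) % q ≡ toℕ z
    undo z = begin
      ((toℕ z + toℕ c) % q + (q ∸ toℕ c)) % q          ≡⟨ %-distribˡ-+ _ (q ∸ toℕ c) q ⟩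
      ((toℕ z + toℕ c) % q % q + (q ∸ toℕ c) % q) % q  ≡⟨ cong (λ t → (t + (q ∸ toℕ c) % q) % q) (m%n%n≡m%n _ q) ⟩
      ((toℕ z + toℕ c) % q + (q ∸ toℕ c) % q) % q      ≡⟨ %-distribˡ-+ (toℕ z + toℕ c) (q ∸ toℕ c) q ⟨
      (toℕ z + toℕ c + (q ∸ toℕ c)) % q                ≡⟨ cong (_% q) (+-assoc (toℕ z) (toℕ c) _) ⟩
      (toℕ z + (toℕ c + (q ∸ toℕ c))) % q              ≡⟨ cong (λ t → (toℕ z + t) % q) (m+[n∸m]≡n (<⇒≤ (toℕ<n c))) ⟩
      (toℕ z + q) % q                                  ≡⟨ [m+n]%n≡m%n (toℕ z) q ⟩
      toℕ z % q                                        ≡⟨ m<n⇒m%n≡m (toℕ<n z) ⟩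
      toℕ z                                            ∎

  w : Z → ℕ
  w = wt2 (suc k)

  w-0 : ∀ {a} → toℕ a ≡ 0 → w a ≡ 0
  w-0 {a} a≡0 with toℕ a ≟ 0
  ... | yes _ = refl
  ... | no a≢0 = ⊥-elim (a≢0 a≡0)

  w-m : ∀ {a} → toℕ a ≡ m → w a ≡ q
  w-m {a} a≡m with toℕ a ≟ 0
  ... | yes a≡0 = ⊥-elim (≢-nonZero⁻¹ m (trans (sym a≡m) a≡0))
  ... | no _ with toℕ a ≟ m
  ...   | yes _ = refl
  ...   | no a≢m = ⊥-elim (a≢m a≡m)

  w-other : ∀ {a} → toℕ a ≢ 0 → toℕ a ≢ m → w a ≡ m
  w-other {a} a≢0 a≢m with toℕ a ≟ 0
  ... | yes a≡0 = ⊥-elim (a≢0 a≡0)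
  ... | no _ with toℕ a ≟ m
  ...   | yes a≡m = ⊥-elim (a≢m a≡m)
  ...   | no _ = refl

  data WeightView (a : Z) : Set where
    at-0     : toℕ a ≡ 0 → w a ≡ 0 → WeightView a
    at-m     : toℕ a ≡ m → w a ≡ q → WeightView a
    at-other : toℕ a ≢ 0 → toℕ a ≢ m → w a ≡ m → WeightView a

  weightView : ∀ a → WeightView a
  weightView a with toℕ a ≟ 0 | toℕ a ≟ m
  ... | yes a≡0 | _       = at-0 a≡0 (w-0 a≡0)
  ... | no _    | yes a≡m = at-m a≡m (w-m a≡m)
  ... | no a≢0  | no a≢m  = at-other a≢0 a≢m (w-other a≢0 a≢m)

  w≤q : ∀ a → w a ≤ q
  w≤q a with weightView a
  ... | at-0 _ w≡0         = subst (_≤ q) (sym w≡0) z≤n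
  ... | at-m _ w≡q         = ≤-reflexive w≡q
  ... | at-other _ _ w≡m   = subst (_≤ q) (sym w≡m) (<⇒≤ m<q)

  +mᶻ-at-0 : ∀ {a} → toℕ a ≡ 0 → toℕ (a +ᶻ mᶻ) ≡ m
  +mᶻ-at-0 a≡0 = trans (cong toℕ (+ᶻ-identityˡ mᶻ a≡0)) toℕ-mᶻ

  +mᶻ-at-m : ∀ {a} → toℕ a ≡ m → toℕ (a +ᶻ mᶻ) ≡ 0
  +mᶻ-at-m {a} a≡m = begin
    toℕ (a +ᶻ mᶻ)         ≡⟨ toℕ-+ᶻ a mᶻ ⟩
    (toℕ a + toℕ mᶻ) % q  ≡⟨ cong₂ (λ s t → (s + t) % q) a≡m toℕ-mᶻ ⟩
    (m + m) % q           ≡⟨ cong (_% q) q≡m+m ⟨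
    q % q                 ≡⟨ n%n≡0 q ⟩
    0                     ∎
    where open ≡-Reasoning

  w-+mᶻ : ∀ a → w (a +ᶻ mᶻ) + w a ≡ q
  w-+mᶻ a with weightView a
  ... | at-0 a≡0 w≡0 = trans (cong₂ _+_ (w-m (+mᶻ-at-0 a≡0)) w≡0) (+-identityʳ q)
  ... | at-m a≡m w≡q = cong₂ _+_ (w-0 (+mᶻ-at-m a≡m)) w≡q
  ... | at-other a≢0 a≢m w≡m = trans (cong₂ _+_ (w-other a+m≢0 a+m≢m) w≡m) (sym q≡m+m)
    where
    a+m≢0 : toℕ (a +ᶻ mᶻ) ≢ 0
    a+m≢0 e = a≢m (trans (cong toℕ (+ᶻ-cancelʳ mᶻ (toℕ-injective (trans e (sym (+mᶻ-at-m toℕ-mᶻ)))))) toℕ-mᶻ)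
    a+m≢m : toℕ (a +ᶻ mᶻ) ≢ m
    a+m≢m e = a≢0 (trans (cong toℕ (+ᶻ-cancelʳ mᶻ (toℕ-injective (trans e (sym (+mᶻ-at-0 toℕ-0ᶻ)))))) toℕ-0ᶻ)

  infixl 7 _·ᶻ_

  _·ᶻ_ : Z → Z → Z
  _·ᶻ_ = mulZ (suc k)

  toℕ-red-·ᶻ : ∀ c a → toℕ (red (suc k) c ·ᶻ a) ≡ (c * toℕ a) % q
  toℕ-red-·ᶻ c a = begin
    toℕ (red (suc k) c ·ᶻ a)            ≡⟨ toℕ-red _ ⟩
    (toℕ (red (suc k) c) * toℕ a) % q   ≡⟨ cong (λ t → (t * toℕ a) % q) (toℕ-red c) ⟩
    (c % q * toℕ a) % q                 ≡⟨ cong (_% q) (*-comm (c % q) (toℕ a)) ⟩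
    (toℕ a * (c % q)) % q               ≡⟨ *-%-absorbʳ (toℕ a) c q ⟩
    (toℕ a * c) % q                     ≡⟨ cong (_% q) (*-comm (toℕ a) c) ⟩
    (c * toℕ a) % q                     ∎
    where open ≡-Reasoning

  toℕ-mᶻ·ᶻ : ∀ a → toℕ (mᶻ ·ᶻ a) ≡ m * (toℕ a % 2)
  toℕ-mᶻ·ᶻ a = begin
    toℕ (mᶻ ·ᶻ a)        ≡⟨ toℕ-red-·ᶻ m a ⟩
    (m * toℕ a) % q      ≡⟨ cong (_% q) (*-comm m (toℕ a)) ⟩
    (toℕ a * m) % (2 * m) ≡⟨ m%n*o≡m*o%[n*o] (toℕ a) 2 m ⟨
    toℕ a % 2 * m        ≡⟨ *-comm (toℕ a % 2) m ⟩
    m * (toℕ a % 2)      ∎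
    where open ≡-Reasoning

  w-mᶻ·ᶻ : ∀ a → w (mᶻ ·ᶻ a) ≡ q * (toℕ a % 2)
  w-mᶻ·ᶻ a with %2≡0⊎%2≡1 (toℕ a)
  ... | inj₁ a%2≡0 = trans (w-0 (trans (toℕ-mᶻ·ᶻ a) (trans (cong (m *_) a%2≡0) (*-zeroʳ m))))
                            (sym (trans (cong (q *_) a%2≡0) (*-zeroʳ q)))
  ... | inj₂ a%2≡1 = trans (w-m (trans (toℕ-mᶻ·ᶻ a) (trans (cong (m *_) a%2≡1) (*-identityʳ m))))
                            (sym (trans (cong (q *_) a%2≡1) (*-identityʳ q)))

  x≢0∧2x≡0⇒x≡m : ∀ {x} → x < q → x ≢ 0 → (2 * x) % q ≡ 0 → x ≡ m
  x≢0∧2x≡0⇒x≡m {x} x<q x≢0 2x≡0 = by-quotient (x / m) (m<n*o⇒m/o<n x<q) (m≡m%n+[m/n]*n x m)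
    where
    instance
      m*2-nonZero : NonZero (m * 2)
      m*2-nonZero = m*n≢0 m 2
    x%m≡0 : x % m ≡ 0
    x%m≡0 = m*n≡0⇒m≡0 (x % m) 2 (begin
      x % m * 2        ≡⟨ m%n*o≡m*o%[n*o] x m 2 ⟩
      x * 2 % (m * 2)  ≡⟨ cong (_% (m * 2)) (*-comm x 2) ⟩
      2 * x % (m * 2)  ≡⟨ %-congʳ (*-comm m 2) ⟩
      2 * x % q        ≡⟨ 2x≡0 ⟩
      0                ∎)
      where open ≡-Reasoning
    by-quotient : ∀ d → d < 2 → x ≡ x % m + d * m → x ≡ m
    by-quotient 0 _ x≡ = ⊥-elim (x≢0 (trans x≡ (trans (+-identityʳ _) x%m≡0)))
    by-quotient 1 _ x≡ = trans x≡ (cong₂ _+_ x%m≡0 (*-identityˡ m))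
    by-quotient (suc (suc _)) (s≤s (s≤s ())) _

  -- The last nonzero term of a, 2a, 4a, … has order two, and m is the only element of order two.
  2^t·ᶻ≡m : ∀ {a} → toℕ a ≢ 0 → ∃ λ t → toℕ (red (suc k) (2 ^ t) ·ᶻ a) ≡ m
  2^t·ᶻ≡m {a} a≢0 =
    let t , ft≢0 , f[1+t]≡0 = last-nonzero f (suc k) f0≢0 f[1+k]≡0
    in t , trans (toℕ-red-·ᶻ (2 ^ t) a) (x≢0∧2x≡0⇒x≡m (m%n<n _ q) ft≢0 (begin
         2 * f t % q                ≡⟨ *-%-absorbʳ 2 (2 ^ t * toℕ a) q ⟩
         2 * (2 ^ t * toℕ a) % q    ≡⟨ cong (_% q) (*-assoc 2 (2 ^ t) (toℕ a)) ⟨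
         f (suc t)                  ≡⟨ f[1+t]≡0 ⟩
         0                          ∎))
    where
    open ≡-Reasoning
    f : ℕ → ℕ
    f t = (2 ^ t * toℕ a) % q
    f0≢0 : f 0 ≢ 0
    f0≢0 f0≡0 = a≢0 (trans (sym (m<n⇒m%n≡m (toℕ<n a))) (trans (cong (_% q) (sym (*-identityˡ (toℕ a)))) f0≡0))
    f[1+k]≡0 : f (suc k) ≡ 0
    f[1+k]≡0 = trans (cong (_% q) (*-comm q (toℕ a))) (m*n%n≡0 (toℕ a) q)

  +ᶻ-fixes⇒0 : ∀ {a b} → toℕ (a +ᶻ b) ≡ toℕ b → toℕ a ≡ 0
  +ᶻ-fixes⇒0 {a} {b} a+b≡b = trans (cong toℕ (+ᶻ-cancelʳ b (toℕ-injective (trans a+b≡b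
    (cong toℕ (sym (+ᶻ-identityˡ b toℕ-0ᶻ))))))) toℕ-0ᶻ

  toℕ-+ᶻ-%2 : ∀ a b → toℕ (a +ᶻ b) % 2 ≡ (toℕ a + toℕ b) % 2
  toℕ-+ᶻ-%2 a b = trans (cong (_% 2) (toℕ-+ᶻ a b)) (m∣n⇒o%n%m≡o%m 2 q _ (divides m (*-comm 2 m)))

  odd-+ᶻ-flips-parity : ∀ a {y} → toℕ y % 2 ≡ 1 → toℕ (a +ᶻ y) % 2 + toℕ a % 2 ≡ 1
  odd-+ᶻ-flips-parity a {y} y-odd = begin
    toℕ (a +ᶻ y) % 2 + toℕ a % 2               ≡⟨ cong (_+ toℕ a % 2) (toℕ-+ᶻ-%2 a y) ⟩
    (toℕ a + toℕ y) % 2 + toℕ a % 2            ≡⟨ cong (_+ toℕ a % 2) (%-distribˡ-+ (toℕ a) (toℕ y) 2) ⟩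
    (toℕ a % 2 + toℕ y % 2) % 2 + toℕ a % 2    ≡⟨ cong (λ t → (toℕ a % 2 + t) % 2 + toℕ a % 2) y-odd ⟩
    (toℕ a % 2 + 1) % 2 + toℕ a % 2            ≡⟨ flip (%2≡0⊎%2≡1 (toℕ a)) ⟩
    1                                          ∎
    where
    open ≡-Reasoning
    flip : ∀ {r} → r ≡ 0 ⊎ r ≡ 1 → (r + 1) % 2 + r ≡ 1
    flip (inj₁ refl) = refl
    flip (inj₂ refl) = refl

  -- With weights in {0, m, 2m} this says (w a - m)(w b - m) ≥ 0, which fails only for {a, b} = {0, m}.
  w-pair-lower : ∀ a b → ¬ (toℕ a ≡ m × toℕ b ≡ 0) → ¬ (toℕ a ≡ 0 × toℕ b ≡ m) →
                 m * (w a + w b) ≤ w a * w b + m * m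
  w-pair-lower a b m0∉ 0m∉ = by-cases (weightView a) (weightView b)
    where
    m*[2m+2m]≡2m*2m : ∀ m → m * (2 * m + 2 * m) ≡ 2 * m * (2 * m)
    m*[2m+2m]≡2m*2m = solve-∀
    m*[2m+m]≡2m*m+m*m : ∀ m → m * (2 * m + m) ≡ 2 * m * m + m * m
    m*[2m+m]≡2m*m+m*m = solve-∀
    m*[m+0]≡m*0+m*m : ∀ m → m * (m + 0) ≡ m * 0 + m * m
    m*[m+0]≡m*0+m*m = solve-∀
    m*[m+2m]≡m*2m+m*m : ∀ m → m * (m + 2 * m) ≡ m * (2 * m) + m * m
    m*[m+2m]≡m*2m+m*m = solve-∀
    m*[m+m]≡m*m+m*m : ∀ m → m * (m + m) ≡ m * m + m * m
    m*[m+m]≡m*m+m*m = solve-∀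
    by-cases : WeightView a → WeightView b → m * (w a + w b) ≤ w a * w b + m * m
    by-cases (at-0 a≡0 _) (at-m b≡m _) = ⊥-elim (0m∉ (a≡0 , b≡m))
    by-cases (at-m a≡m _) (at-0 b≡0 _) = ⊥-elim (m0∉ (a≡m , b≡0))
    by-cases (at-0 _ wa) (at-0 _ wb) rewrite wa | wb = ≤-trans (≤-reflexive (*-zeroʳ m)) z≤n
    by-cases (at-0 _ wa) (at-other _ _ wb) rewrite wa | wb = ≤-refl
    by-cases (at-m _ wa) (at-m _ wb) rewrite wa | wb =
      ≤-trans (≤-reflexive (m*[2m+2m]≡2m*2m m)) (m≤m+n _ (m * m))
    by-cases (at-m _ wa) (at-other _ _ wb) rewrite wa | wb = ≤-reflexive (m*[2m+m]≡2m*m+m*m m)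
    by-cases (at-other _ _ wa) (at-0 _ wb) rewrite wa | wb = ≤-reflexive (m*[m+0]≡m*0+m*m m)
    by-cases (at-other _ _ wa) (at-m _ wb) rewrite wa | wb = ≤-reflexive (m*[m+2m]≡m*2m+m*m m)
    by-cases (at-other _ _ wa) (at-other _ _ wb) rewrite wa | wb = ≤-reflexive (m*[m+m]≡m*m+m*m m)

  -- That is, (w a - m)² is m² when a ∈ {0, m} and 0 otherwise.
  w-square : ∀ a → w a * w a + m * m ≡ q * w a + m * m * (𝟙 (0 ≟ toℕ a) + 𝟙 (m ≟ toℕ a))
  w-square a with weightView a
  ... | at-0 a≡0 wa
    rewrite wa | 𝟙-yes (0 ≟ toℕ a) (sym a≡0) | 𝟙-no (m ≟ toℕ a) (λ m≡a → m≢0 (trans m≡a a≡0)) =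
      sym (cong₂ _+_ (*-zeroʳ q) (*-identityʳ (m * m)))
  ... | at-m a≡m wa
    rewrite wa | 𝟙-no (0 ≟ toℕ a) (λ 0≡a → m≢0 (trans (sym a≡m) (sym 0≡a))) | 𝟙-yes (m ≟ toℕ a) (sym a≡m) =
      cong (q * q +_) (sym (*-identityʳ (m * m)))
  ... | at-other a≢0 a≢m wa
    rewrite wa | 𝟙-no (0 ≟ toℕ a) (a≢0 ∘ sym) | 𝟙-no (m ≟ toℕ a) (a≢m ∘ sym) =
      m*m+m*m≡2m*m+m*m*0 m
    where
    m*m+m*m≡2m*m+m*m*0 : ∀ m → m * m + m * m ≡ 2 * m * m + m * m * 0
    m*m+m*m≡2m*m+m*m*0 = solve-∀

  0ᵛ : ∀ {n} → Vec Z n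
  0ᵛ = replicate _ 0ᶻ

  _≟ᵛ_ : ∀ {n} → DecidableEquality (Vec Z n)
  _≟ᵛ_ = ≡-dec Fin._≟_

  _+ᵛ_ : ∀ {n} → Vec Z n → Vec Z n → Vec Z n
  _+ᵛ_ = zipWith _+ᶻ_

  lookup-+ᵛ : ∀ {n} (x y : Vec Z n) i → lookup (x +ᵛ y) i ≡ lookup x i +ᶻ lookup y i
  lookup-+ᵛ x y i = lookup-zipWith _+ᶻ_ i x y

  +ᵛ-cancelʳ : ∀ {n} {x x′ : Vec Z n} y → x +ᵛ y ≡ x′ +ᵛ y → x ≡ x′
  +ᵛ-cancelʳ {x = x} {x′} y x+y≡x′+y = begin
    x                   ≡⟨ tabulate∘lookup x ⟨
    tabulate (lookup x) ≡⟨ tabulate-cong (λ i → +ᶻ-cancelʳ (lookup y i) (begin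
      lookup x i +ᶻ lookup y i   ≡⟨ lookup-+ᵛ x y i ⟨
      lookup (x +ᵛ y) i          ≡⟨ cong (λ v → lookup v i) x+y≡x′+y ⟩
      lookup (x′ +ᵛ y) i         ≡⟨ lookup-+ᵛ x′ y i ⟩
      lookup x′ i +ᶻ lookup y i  ∎)) ⟩
    tabulate (lookup x′) ≡⟨ tabulate∘lookup x′ ⟩
    x′                  ∎
    where open ≡-Reasoning

  wt : ∀ {n} → Vec Z n → ℕ
  wt {n} x = ∑[ i ∈ allFin n ] w (lookup x i)

  subZ-0ᶻ : ∀ a → subZ (suc k) a 0ᶻ ≡ a
  subZ-0ᶻ a = toℕ-injective (begin
    toℕ (subZ (suc k) a 0ᶻ)          ≡⟨ toℕ-red _ ⟩
    (toℕ a + (q ∸ toℕ 0ᶻ)) % q       ≡⟨ cong (λ t → (toℕ a + (q ∸ t)) % q) toℕ-0ᶻ ⟩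
    (toℕ a + q) % q                  ≡⟨ [m+n]%n≡m%n (toℕ a) q ⟩
    toℕ a % q                        ≡⟨ m<n⇒m%n≡m (toℕ<n a) ⟩
    toℕ a                            ∎)
    where open ≡-Reasoning

  dist2-from-0 : ∀ {n} (x : Vec Z n) → dist2 (suc k) n (replicate n 0ᶻ) x ≡ wt x
  dist2-from-0 [] = refl
  dist2-from-0 (a ∷ x) = sym (trans (∑-allFin-suc (λ i → w (lookup (a ∷ x) i)))
    (cong₂ _+_ (cong w (sym (subZ-0ᶻ a))) (sym (dist2-from-0 x))))

  wt≤n*q : ∀ {n} (x : Vec Z n) → wt x ≤ n * q
  wt≤n*q {n} x = begin
    wt x                  ≤⟨ ∑-mono-≤ (allFin n) (λ {i} _ → w≤q (lookup x i)) ⟩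
    ∑[ i ∈ allFin n ] q   ≡⟨ ∑-allFin-const n q ⟩
    n * q                 ∎
    where open ≤-Reasoning

  wt-0ᵛ : ∀ {n} → wt (0ᵛ {n}) ≡ 0
  wt-0ᵛ {n} = ∑-zero _ (allFin n) (λ {i} _ → w-0 (trans (cong toℕ (lookup-replicate i 0ᶻ)) toℕ-0ᶻ))

  oddCoordinates : ∀ {n} → Vec Z n → ℕ
  oddCoordinates {n} x = ∑[ i ∈ allFin n ] (toℕ (lookup x i) % 2)

  wt-mᶻ· : ∀ {n} (x : Vec Z n) → wt (map (mᶻ ·ᶻ_) x) ≡ q * oddCoordinates x
  wt-mᶻ· {n} x = trans (∑-cong (allFin n) (λ {i} _ → trans (cong w (lookup-map i _ x)) (w-mᶻ·ᶻ (lookup x i))))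
    (∑-*ˡ q _ (allFin n))

  oddCoordinates-0ᵛ : ∀ {n} → oddCoordinates (0ᵛ {n}) ≡ 0
  oddCoordinates-0ᵛ {n} = ∑-zero _ (allFin n) (λ {i} _ → cong (_% 2) (trans (cong toℕ (lookup-replicate i 0ᶻ)) toℕ-0ᶻ))

  oddCoordinates≡n⇒all-odd : ∀ {n} (x : Vec Z n) → oddCoordinates x ≡ n → All (λ a → Odd (toℕ a)) x
  oddCoordinates≡n⇒all-odd {n} x odd≡n = lookup⁻ (λ i → ∑-squeeze (allFin n) (λ {j} _ → %2≤1 (lookup x j))
    (≤-reflexive (trans (∑-allFin-const n 1) (trans (*-identityʳ n) (sym odd≡n)))) (∈-allFin i))
    where
    %2≤1 : ∀ a → toℕ a % 2 ≤ 1
    %2≤1 a = m<1+n⇒m≤n (m%n<n (toℕ a) 2)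

-- Linear codes

module LinearCode (k n : ℕ) (D : List (Vec (Zq (suc k)) n)) (D-unique : Unique D)
  (+-closed : ∀ {x y} → x ∈ D → y ∈ D → zipWith (addZ (suc k)) x y ∈ D)
  (·-closed : ∀ c {x} → x ∈ D → map (mulZ (suc k) c) x ∈ D)
  where

  open Residues k

  ∑-translate : ∀ (h : Vec Z n → ℕ) {y} → y ∈ D → ∑[ x ∈ D ] h (x +ᵛ y) ≡ ∑ D h
  ∑-translate h y∈D = ∑-∘-injective h D-unique (+ᵛ-cancelʳ _) (λ x∈D → +-closed x∈D y∈D)

  ∑+∑-translate : ∀ (h g : Vec Z n → ℕ) {y} → y ∈ D → (∀ x → h (x +ᵛ y) + h x ≡ g x) → ∑ D h + ∑ D h ≡ ∑ D g
  ∑+∑-translate h g y∈D h+h≡g = begin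
    ∑ D h + ∑ D h                     ≡⟨ cong (_+ ∑ D h) (∑-translate h y∈D) ⟨
    ∑[ x ∈ D ] h (x +ᵛ _) + ∑ D h     ≡⟨ ∑-+ _ h D ⟨
    ∑[ x ∈ D ] (h (x +ᵛ _) + h x)     ≡⟨ ∑-cong D (λ {x} _ → h+h≡g x) ⟩
    ∑ D g                             ∎
    where open ≡-Reasoning

  count : Fin n → ℕ → ℕ
  count i c = ∑[ x ∈ D ] 𝟙 (c ≟ toℕ (lookup x i))

  count-translate : ∀ i {y} → y ∈ D → count i (toℕ (lookup y i)) ≡ count i 0
  count-translate i {y} y∈D = begin
    count i (toℕ (lookup y i))                                ≡⟨ ∑-translate (λ x → 𝟙 (toℕ (lookup y i) ≟ toℕ (lookup x i))) y∈D ⟨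
    ∑[ x ∈ D ] 𝟙 (toℕ (lookup y i) ≟ toℕ (lookup (x +ᵛ y) i)) ≡⟨ ∑-cong D (λ {x} _ → 𝟙-cong _ _ (fixes⇒0 x) (0⇒fixes x)) ⟩
    count i 0                                                 ∎
    where
    open ≡-Reasoning
    fixes⇒0 : ∀ x → toℕ (lookup y i) ≡ toℕ (lookup (x +ᵛ y) i) → 0 ≡ toℕ (lookup x i)
    fixes⇒0 x fixes = sym (+ᶻ-fixes⇒0 (trans (cong toℕ (sym (lookup-+ᵛ x y i))) (sym fixes)))
    0⇒fixes : ∀ x → 0 ≡ toℕ (lookup x i) → toℕ (lookup y i) ≡ toℕ (lookup (x +ᵛ y) i)
    0⇒fixes x 0≡xᵢ = cong toℕ (sym (trans (lookup-+ᵛ x y i) (+ᶻ-identityˡ (lookup y i) (sym 0≡xᵢ))))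

  count≤count-0 : ∀ i c → count i c ≤ count i 0
  count≤count-0 i c with any? (λ y → c ≟ toℕ (lookup y i)) D
  ... | yes c∈column = let y , y∈D , c≡yᵢ = find c∈column in
    ≤-reflexive (trans (cong (count i) c≡yᵢ) (count-translate i y∈D))
  ... | no c∉column = subst (_≤ count i 0) (sym (∑-zero _ D (λ x∈D → 𝟙-no _ (c∉column ∘ lose x∈D)))) z≤n

  length≤∣values∣*count-0 : ∀ i {values} → Unique values → (∀ {x} → x ∈ D → toℕ (lookup x i) ∈ values) →
                            length D ≤ length values * count i 0
  length≤∣values∣*count-0 i {values} values! column⊆values = begin
    length D                                              ≡⟨ trans (∑-const 1 D) (*-identityʳ (length D)) ⟨
    ∑[ x ∈ D ] 1                                          ≡⟨ ∑-cong D (λ x∈D → ∑-𝟙-≟ _≟_ values! (column⊆values x∈D)) ⟨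
    ∑[ x ∈ D ] ∑[ c ∈ values ] 𝟙 (c ≟ toℕ (lookup x i))   ≡⟨ ∑-swap (λ x c → 𝟙 (c ≟ toℕ (lookup x i))) D values ⟩
    ∑[ c ∈ values ] count i c                             ≤⟨ ∑-mono-≤ values (λ _ → count≤count-0 i _) ⟩
    ∑[ c ∈ values ] count i 0                             ≡⟨ ∑-const (count i 0) values ⟩
    length values * count i 0                             ∎
    where open ≤-Reasoning

  length≤q*count-0 : ∀ i → length D ≤ q * count i 0
  length≤q*count-0 i = subst (λ l → length D ≤ l * count i 0) (length-upTo q)
    (length≤∣values∣*count-0 i (Unique.upTo⁺ q) (λ {x} _ → ∈-upTo⁺ (toℕ<n (lookup x i))))

  length≤m*count-0 : ∀ i → (∀ {x} → x ∈ D → toℕ (lookup x i) % 2 ≡ 0) → length D ≤ m * count i 0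
  length≤m*count-0 i column-even = subst (λ l → length D ≤ l * count i 0) (trans (length-map (2 *_) (upTo m)) (length-upTo m))
    (length≤∣values∣*count-0 i (Unique.map⁺ (*-cancelˡ-≡ _ _ 2) (Unique.upTo⁺ m))
      (λ {x} x∈D → even<2m⇒∈doubles (column-even x∈D) (toℕ<n (lookup x i))))

  m∈column : Fin n → Set
  m∈column i = ∃ λ y → y ∈ D × toℕ (lookup y i) ≡ m

  m∈column⊎column≡0 : ∀ i → m∈column i ⊎ (∀ {x} → x ∈ D → toℕ (lookup x i) ≡ 0)
  m∈column⊎column≡0 i with any? (λ y → toℕ (lookup y i) ≟ m) D
  ... | yes m∈ = inj₁ (find m∈)
  ... | no m∉ = inj₂ column≡0
    where
    column≡0 : ∀ {x} → x ∈ D → toℕ (lookup x i) ≡ 0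
    column≡0 {x} x∈D with toℕ (lookup x i) ≟ 0
    ... | yes xᵢ≡0 = xᵢ≡0
    ... | no xᵢ≢0 = let t , 2^t·xᵢ≡m = 2^t·ᶻ≡m xᵢ≢0 in
      ⊥-elim (m∉ (lose (·-closed (red (suc k) (2 ^ t)) x∈D)
        (trans (cong toℕ (lookup-map i _ x)) 2^t·xᵢ≡m)))

  columnWeight : Fin n → ℕ
  columnWeight i = ∑[ x ∈ D ] w (lookup x i)

  translate-by-m : ∀ {y : Vec Z n} i → toℕ (lookup y i) ≡ m → ∀ x → lookup (x +ᵛ y) i ≡ lookup x i +ᶻ mᶻ
  translate-by-m {y} i yᵢ≡m x = trans (lookup-+ᵛ x y i) (cong (lookup x i +ᶻ_) (toℕ-injective (trans yᵢ≡m (sym toℕ-mᶻ))))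

  columnWeight-m∈column : ∀ {i} → m∈column i → columnWeight i ≡ length D * m
  columnWeight-m∈column {i} (y , y∈D , yᵢ≡m) = m+m≡n+n⇒m≡n (begin
    columnWeight i + columnWeight i  ≡⟨ ∑+∑-translate (λ x → w (lookup x i)) (λ _ → q) y∈D
                                          (λ x → trans (cong (λ a → w a + w (lookup x i)) (translate-by-m i yᵢ≡m x)) (w-+mᶻ (lookup x i))) ⟩
    ∑[ x ∈ D ] q                     ≡⟨ ∑-const q D ⟩
    length D * q                     ≡⟨ cong (length D *_) q≡m+m ⟩
    length D * (m + m)               ≡⟨ *-distribˡ-+ (length D) m m ⟩
    length D * m + length D * m      ∎)
    where open ≡-Reasoning

  columnWeight-column≡0 : ∀ {i} → (∀ {x} → x ∈ D → toℕ (lookup x i) ≡ 0) → columnWeight i ≡ 0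
  columnWeight-column≡0 column≡0 = ∑-zero _ D (w-0 ∘ column≡0)

  columnWeight≤length*m : ∀ i → columnWeight i ≤ length D * m
  columnWeight≤length*m i with m∈column⊎column≡0 i
  ... | inj₁ m∈ = ≤-reflexive (columnWeight-m∈column m∈)
  ... | inj₂ column≡0 = subst (_≤ length D * m) (sym (columnWeight-column≡0 column≡0)) z≤n

  pairWeight : Fin n → Fin n → ℕ
  pairWeight i j = ∑[ x ∈ D ] (w (lookup x i) * w (lookup x j))

  pairWeight-comm : ∀ i j → pairWeight i j ≡ pairWeight j i
  pairWeight-comm i j = ∑-cong D (λ {x} _ → *-comm (w (lookup x i)) (w (lookup x j)))

  pairWeight-m0∈columns : ∀ {i j y} → y ∈ D → toℕ (lookup y i) ≡ m → toℕ (lookup y j) ≡ 0 →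
                          m∈column j → pairWeight i j ≡ length D * (m * m)
  pairWeight-m0∈columns {i} {j} {y} y∈D yᵢ≡m yⱼ≡0 m∈columnⱼ = m+m≡n+n⇒m≡n (begin
    pairWeight i j + pairWeight i j          ≡⟨ ∑+∑-translate (λ x → w (lookup x i) * w (lookup x j)) (λ x → q * w (lookup x j)) y∈D pointwise ⟩
    ∑[ x ∈ D ] (q * w (lookup x j))          ≡⟨ ∑-*ˡ q _ D ⟩
    q * columnWeight j                       ≡⟨ cong (q *_) (columnWeight-m∈column m∈columnⱼ) ⟩
    q * (length D * m)                       ≡⟨ q*[N*m]≡N*[m*m]+N*[m*m] (length D) ⟩
    length D * (m * m) + length D * (m * m)  ∎)
    where
    open ≡-Reasoning
    pointwise : ∀ x → w (lookup (x +ᵛ y) i) * w (lookup (x +ᵛ y) j) + w (lookup x i) * w (lookup x j) ≡ q * w (lookup x j)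
    pointwise x = begin
      w (lookup (x +ᵛ y) i) * w (lookup (x +ᵛ y) j) + w (lookup x i) * w (lookup x j)
        ≡⟨ cong₂ (λ a b → w a * w b + w (lookup x i) * w (lookup x j)) (translate-by-m i yᵢ≡m x)
                 (trans (lookup-+ᵛ x y j) (+ᶻ-identityʳ (lookup x j) yⱼ≡0)) ⟩
      w (lookup x i +ᶻ mᶻ) * w (lookup x j) + w (lookup x i) * w (lookup x j)
        ≡⟨ *-distribʳ-+ (w (lookup x j)) (w (lookup x i +ᶻ mᶻ)) (w (lookup x i)) ⟨
      (w (lookup x i +ᶻ mᶻ) + w (lookup x i)) * w (lookup x j)
        ≡⟨ cong (_* w (lookup x j)) (w-+mᶻ (lookup x i)) ⟩
      q * w (lookup x j) ∎

  pairWeight-lower : ∀ {i j} → m∈column i → m∈column j → length D * (m * m) ≤ pairWeight i j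
  pairWeight-lower {i} {j} m∈columnᵢ m∈columnⱼ
    with any? (λ y → (toℕ (lookup y i) ≟ m) ×-dec (toℕ (lookup y j) ≟ 0)) D
       | any? (λ y → (toℕ (lookup y i) ≟ 0) ×-dec (toℕ (lookup y j) ≟ m)) D
  ... | yes m0∈ | _ = let y , y∈D , yᵢ≡m , yⱼ≡0 = find m0∈ in
    ≤-reflexive (sym (pairWeight-m0∈columns y∈D yᵢ≡m yⱼ≡0 m∈columnⱼ))
  ... | no _ | yes 0m∈ = let y , y∈D , yᵢ≡0 , yⱼ≡m = find 0m∈ in
    ≤-reflexive (sym (trans (pairWeight-comm i j) (pairWeight-m0∈columns y∈D yⱼ≡m yᵢ≡0 m∈columnᵢ)))
  ... | no m0∉ | no 0m∉ = +-cancelʳ-≤ (length D * (m * m)) _ _ (begin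
    length D * (m * m) + length D * (m * m)              ≡⟨ m*[N*m+N*m]≡N*[m*m]+N*[m*m] m (length D) ⟨
    m * (length D * m + length D * m)                    ≡⟨ cong (m *_) (cong₂ _+_ (columnWeight-m∈column m∈columnᵢ) (columnWeight-m∈column m∈columnⱼ)) ⟨
    m * (columnWeight i + columnWeight j)                ≡⟨ cong (m *_) (∑-+ _ _ D) ⟨
    m * ∑[ x ∈ D ] (w (lookup x i) + w (lookup x j))     ≡⟨ ∑-*ˡ m _ D ⟨
    ∑[ x ∈ D ] (m * (w (lookup x i) + w (lookup x j)))   ≤⟨ ∑-mono-≤ D (λ x∈D → w-pair-lower _ _ (m0∉ ∘ lose x∈D) (0m∉ ∘ lose x∈D)) ⟩
    ∑[ x ∈ D ] (w (lookup x i) * w (lookup x j) + m * m) ≡⟨ ∑-+ _ _ D ⟩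
    pairWeight i j + ∑[ x ∈ D ] (m * m)                  ≡⟨ cong (pairWeight i j +_) (∑-const (m * m) D) ⟩
    pairWeight i j + length D * (m * m)                  ∎)
    where
    open ≤-Reasoning
    m*[N*m+N*m]≡N*[m*m]+N*[m*m] : ∀ m N → m * (N * m + N * m) ≡ N * (m * m) + N * (m * m)
    m*[N*m+N*m]≡N*[m*m]+N*[m*m] = solve-∀

  pairWeight-diagonal : ∀ {i} → m∈column i → pairWeight i i ≡ length D * (m * m) + m * m * (count i 0 + count i m)
  pairWeight-diagonal {i} m∈columnᵢ = +-cancelʳ-≡ (length D * (m * m)) _ _ (begin
    pairWeight i i + length D * (m * m)                       ≡⟨ cong (pairWeight i i +_) (∑-const (m * m) D) ⟨
    pairWeight i i + ∑[ x ∈ D ] (m * m)                       ≡⟨ ∑-+ _ _ D ⟨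
    ∑[ x ∈ D ] (w (lookup x i) * w (lookup x i) + m * m)      ≡⟨ ∑-cong D (λ {x} _ → w-square (lookup x i)) ⟩
    ∑[ x ∈ D ] (q * w (lookup x i) + m * m * (𝟙 (0 ≟ toℕ (lookup x i)) + 𝟙 (m ≟ toℕ (lookup x i))))
                                                              ≡⟨ ∑-+ _ _ D ⟩
    ∑[ x ∈ D ] (q * w (lookup x i)) + ∑[ x ∈ D ] (m * m * (𝟙 (0 ≟ toℕ (lookup x i)) + 𝟙 (m ≟ toℕ (lookup x i))))
                                                              ≡⟨ cong₂ _+_ (∑-*ˡ q _ D) (trans (∑-*ˡ (m * m) _ D) (cong (m * m *_) (∑-+ _ _ D))) ⟩
    q * columnWeight i + m * m * (count i 0 + count i m)      ≡⟨ cong (λ s → q * s + m * m * (count i 0 + count i m)) (columnWeight-m∈column m∈columnᵢ) ⟩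
    q * (length D * m) + m * m * (count i 0 + count i m)      ≡⟨ cong (_+ m * m * (count i 0 + count i m)) (q*[N*m]≡N*[m*m]+N*[m*m] (length D)) ⟩
    length D * (m * m) + length D * (m * m) + m * m * (count i 0 + count i m)
                                                              ≡⟨ xy∙z≈xz∙y (length D * (m * m)) _ _ ⟩
    length D * (m * m) + m * m * (count i 0 + count i m) + length D * (m * m) ∎)
    where open ≡-Reasoning

  oddCount : Fin n → ℕ
  oddCount i = ∑[ x ∈ D ] (toℕ (lookup x i) % 2)

  oddCount-half : ∀ {i y} → y ∈ D → toℕ (lookup y i) % 2 ≡ 1 → oddCount i + oddCount i ≡ length D
  oddCount-half {i} {y} y∈D yᵢ-odd = begin
    oddCount i + oddCount i  ≡⟨ ∑+∑-translate (λ x → toℕ (lookup x i) % 2) (λ _ → 1) y∈D flips ⟩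
    ∑[ x ∈ D ] 1             ≡⟨ ∑-const 1 D ⟩
    length D * 1             ≡⟨ *-identityʳ (length D) ⟩
    length D                 ∎
    where
    open ≡-Reasoning
    flips : ∀ x → toℕ (lookup (x +ᵛ y) i) % 2 + toℕ (lookup x i) % 2 ≡ 1
    flips x = trans (cong (λ a → toℕ a % 2 + toℕ (lookup x i) % 2) (lookup-+ᵛ x y i)) (odd-+ᶻ-flips-parity (lookup x i) yᵢ-odd)

-- Linear codes of size n·2^(k+1) and doubled minimum distance n·2^k

module Extremal (k n : ℕ) (D : List (Vec (Zq (suc k)) n)) (D-unique : Unique D)
  (+-closed : ∀ {x y} → x ∈ D → y ∈ D → zipWith (addZ (suc k)) x y ∈ D)
  (·-closed : ∀ c {x} → x ∈ D → map (mulZ (suc k) c) x ∈ D)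
  (0∈D : replicate n (zeroZ (suc k)) ∈ D)
  (|D|≡n*q : length D ≡ n * 2 ^ suc k)
  (wt-lower : ∀ {x} → x ∈ D → x ≢ replicate n (zeroZ (suc k)) → n * 2 ^ k ≤ Residues.wt k x)
  (1≤n : 1 ≤ n)
  where

  open Residues k
  open LinearCode k n D D-unique +-closed ·-closed

  N A : ℕ
  N = length D
  A = n * m

  ∑-𝟙-0ᵛ : ∑[ x ∈ D ] 𝟙 (x ≟ᵛ 0ᵛ) ≡ 1
  ∑-𝟙-0ᵛ = ∑-𝟙-≟ _≟ᵛ_ D-unique 0∈D

  N*A≤∑wt+A : N * A ≤ ∑ D wt + A
  N*A≤∑wt+A = begin
    N * A                                 ≡⟨ ∑-const A D ⟨
    ∑[ x ∈ D ] A                          ≤⟨ ∑-mono-≤ D pointwise ⟩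
    ∑[ x ∈ D ] (wt x + A * 𝟙 (x ≟ᵛ 0ᵛ))   ≡⟨ ∑-+ wt _ D ⟩
    ∑ D wt + ∑[ x ∈ D ] (A * 𝟙 (x ≟ᵛ 0ᵛ)) ≡⟨ cong (∑ D wt +_) (trans (∑-*ˡ A _ D) (trans (cong (A *_) ∑-𝟙-0ᵛ) (*-identityʳ A))) ⟩
    ∑ D wt + A                            ∎
    where
    open ≤-Reasoning
    pointwise : ∀ {x} → x ∈ D → A ≤ wt x + A * 𝟙 (x ≟ᵛ 0ᵛ)
    pointwise {x} x∈D with x ≟ᵛ 0ᵛ
    ... | yes _ = subst (A ≤_) (cong (wt x +_) (sym (*-identityʳ A))) (m≤n+m A (wt x))
    ... | no x≢0 = subst (A ≤_) (sym (trans (cong (wt x +_) (*-zeroʳ A)) (+-identityʳ (wt x)))) (wt-lower x∈D x≢0)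

  ∑-wt-by-columns : ∑ D wt ≡ ∑[ i ∈ allFin n ] columnWeight i
  ∑-wt-by-columns = ∑-swap (λ x i → w (lookup x i)) D (allFin n)

  m∈every-column : ∀ i → m∈column i
  m∈every-column i with m∈column⊎column≡0 i
  ... | inj₁ m∈ = m∈
  ... | inj₂ column≡0 = ⊥-elim (first-moment-contradiction (trans |D|≡n*q (cong (n *_) q≡m+m)) 1≤n 0<m N*A≤∑wt+A
    (subst₂ (λ s l → s + N * m ≤ l * (N * m)) (sym ∑-wt-by-columns) (length-allFin n)
      (∑+d≤length*c columnWeight (N * m) (N * m) (∈-allFin i) (λ {j} _ → columnWeight≤length*m j)
        (≤-reflexive (cong (_+ N * m) (columnWeight-column≡0 column≡0))))))

  ∑-wt : ∑ D wt ≡ n * (N * m)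
  ∑-wt = begin
    ∑ D wt                              ≡⟨ ∑-wt-by-columns ⟩
    ∑[ i ∈ allFin n ] columnWeight i    ≡⟨ ∑-cong (allFin n) (λ {i} _ → columnWeight-m∈column (m∈every-column i)) ⟩
    ∑[ i ∈ allFin n ] (N * m)           ≡⟨ ∑-allFin-const n (N * m) ⟩
    n * (N * m)                         ∎
    where open ≡-Reasoning

  zeroOrM : Fin n → ℕ
  zeroOrM i = count i 0 + count i m

  n≤count-0 : ∀ i → n ≤ count i 0
  n≤count-0 i = *-cancelˡ-≤ q (subst (_≤ q * count i 0) (trans |D|≡n*q (*-comm n q)) (length≤q*count-0 i))

  count-m≡count-0 : ∀ i → count i m ≡ count i 0
  count-m≡count-0 i = let y , y∈D , yᵢ≡m = m∈every-column i in
    trans (cong (count i) (sym yᵢ≡m)) (count-translate i y∈D)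

  2n≤zeroOrM : ∀ i → n + n ≤ zeroOrM i
  2n≤zeroOrM i = subst (n + n ≤_) (cong (count i 0 +_) (sym (count-m≡count-0 i))) (+-mono-≤ (n≤count-0 i) (n≤count-0 i))

  4n≤zeroOrM-if-even : ∀ i → (∀ {x} → x ∈ D → toℕ (lookup x i) % 2 ≡ 0) → (n + n) + (n + n) ≤ zeroOrM i
  4n≤zeroOrM-if-even i column-even =
    subst ((n + n) + (n + n) ≤_) (cong (count i 0 +_) (sym (count-m≡count-0 i))) (+-mono-≤ 2n≤count-0 2n≤count-0)
    where
    2n≤count-0 : n + n ≤ count i 0
    2n≤count-0 = *-cancelˡ-≤ m (subst (_≤ m * count i 0) (trans |D|≡n*q (n*2m≡m*[n+n] n m)) (length≤m*count-0 i column-even))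
      where
      n*2m≡m*[n+n] : ∀ n m → n * (2 * m) ≡ m * (n + n)
      n*2m≡m*[n+n] = solve-∀

  ∑-wt² : ∑[ x ∈ D ] (wt x * wt x) ≡ ∑[ i ∈ allFin n ] ∑[ j ∈ allFin n ] pairWeight i j
  ∑-wt² = begin
    ∑[ x ∈ D ] (wt x * wt x)                                                            ≡⟨ ∑-cong D (λ {x} _ → ∑-square (λ i → w (lookup x i)) (allFin n)) ⟩
    ∑[ x ∈ D ] ∑[ i ∈ allFin n ] ∑[ j ∈ allFin n ] (w (lookup x i) * w (lookup x j))   ≡⟨ ∑-swap _ D (allFin n) ⟩
    ∑[ i ∈ allFin n ] ∑[ x ∈ D ] ∑[ j ∈ allFin n ] (w (lookup x i) * w (lookup x j))   ≡⟨ ∑-cong (allFin n) (λ {i} _ → ∑-swap _ D (allFin n)) ⟩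
    ∑[ i ∈ allFin n ] ∑[ j ∈ allFin n ] pairWeight i j                                  ∎
    where open ≡-Reasoning

  ∑-wt²-lower : n * (n * (N * (m * m))) + m * m * ∑[ i ∈ allFin n ] zeroOrM i ≤ ∑[ x ∈ D ] (wt x * wt x)
  ∑-wt²-lower = begin
    n * (n * (N * (m * m))) + m * m * ∑[ i ∈ allFin n ] zeroOrM i
      ≡⟨ cong₂ _+_ (∑-allFin-const n (n * (N * (m * m)))) (∑-*ˡ (m * m) zeroOrM (allFin n)) ⟨
    ∑[ i ∈ allFin n ] (n * (N * (m * m))) + ∑[ i ∈ allFin n ] (m * m * zeroOrM i)
      ≡⟨ ∑-+ (λ _ → n * (N * (m * m))) (λ i → m * m * zeroOrM i) (allFin n) ⟨
    ∑[ i ∈ allFin n ] (n * (N * (m * m)) + m * m * zeroOrM i)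
      ≤⟨ ∑-mono-≤ (allFin n) (λ {i} _ → row-lower i) ⟩
    ∑[ i ∈ allFin n ] ∑[ j ∈ allFin n ] pairWeight i j
      ≡⟨ ∑-wt² ⟨
    ∑[ x ∈ D ] (wt x * wt x)
      ∎
    where
    open ≤-Reasoning
    row-lower : ∀ i → n * (N * (m * m)) + m * m * zeroOrM i ≤ ∑[ j ∈ allFin n ] pairWeight i j
    row-lower i = subst (λ l → l * (N * (m * m)) + m * m * zeroOrM i ≤ ∑[ j ∈ allFin n ] pairWeight i j) (length-allFin n)
      (length*c+d≤∑ (pairWeight i) (N * (m * m)) (m * m * zeroOrM i) (∈-allFin i)
        (λ {j} _ → pairWeight-lower (m∈every-column i) (m∈every-column j))
        (≤-reflexive (sym (pairWeight-diagonal (m∈every-column i)))))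

  wt≤2A : ∀ (x : Vec Z n) → wt x ≤ A + A
  wt≤2A x = subst (wt x ≤_) (trans (cong (n *_) q≡m+m) (*-distribˡ-+ n m m)) (wt≤n*q x)

  B : ℕ
  B = A * A + A * A

  plotkin-pointwise : ∀ {x} → x ∈ D → wt x * wt x + B ≤ 3 * A * wt x + B * 𝟙 (x ≟ᵛ 0ᵛ)
  plotkin-pointwise {x} x∈D with x ≟ᵛ 0ᵛ
  ... | yes refl rewrite wt-0ᵛ {n} = ≤-reflexive (sym (cong₂ _+_ (*-zeroʳ (3 * A)) (*-identityʳ B)))
  ... | no x≢0 = subst (wt x * wt x + B ≤_) (sym (trans (cong (3 * A * wt x +_) (*-zeroʳ B)) (+-identityʳ _)))
    (A≤W≤2A⇒W²+2A²≤3AW (wt-lower x∈D x≢0) (wt≤2A x))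

  ∑-plotkin-lhs : ∑[ x ∈ D ] (wt x * wt x + B) ≡ ∑[ x ∈ D ] (wt x * wt x) + N * B
  ∑-plotkin-lhs = trans (∑-+ _ _ D) (cong (∑[ x ∈ D ] (wt x * wt x) +_) (∑-const B D))

  ∑-plotkin-rhs : ∑[ x ∈ D ] (3 * A * wt x + B * 𝟙 (x ≟ᵛ 0ᵛ)) ≡ n * (n * (N * (m * m))) + m * m * (n * (n + n)) + N * B
  ∑-plotkin-rhs = begin
    ∑[ x ∈ D ] (3 * A * wt x + B * 𝟙 (x ≟ᵛ 0ᵛ))                 ≡⟨ ∑-+ _ _ D ⟩
    ∑[ x ∈ D ] (3 * A * wt x) + ∑[ x ∈ D ] (B * 𝟙 (x ≟ᵛ 0ᵛ))    ≡⟨ cong₂ _+_ (trans (∑-*ˡ (3 * A) wt D) (cong (3 * A *_) ∑-wt))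
                                                                             (trans (∑-*ˡ B _ D) (cong (B *_) ∑-𝟙-0ᵛ)) ⟩
    3 * A * (n * (N * m)) + B * 1                                ≡⟨ expand n m N ⟩
    n * (n * (N * (m * m))) + m * m * (n * (n + n)) + N * B      ∎
    where
    open ≡-Reasoning
    expand : ∀ n m N → 3 * (n * m) * (n * (N * m)) + (n * m * (n * m) + n * m * (n * m)) * 1 ≡
                       n * (n * (N * (m * m))) + m * m * (n * (n + n)) + N * (n * m * (n * m) + n * m * (n * m))
    expand = solve-∀

  ∑-plotkin-rhs≤lhs : ∑[ x ∈ D ] (3 * A * wt x + B * 𝟙 (x ≟ᵛ 0ᵛ)) ≤ ∑[ x ∈ D ] (wt x * wt x + B)
  ∑-plotkin-rhs≤lhs = subst₂ _≤_ (sym ∑-plotkin-rhs) (sym ∑-plotkin-lhs) (+-monoˡ-≤ (N * B) (begin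
    n * (n * (N * (m * m))) + m * m * (n * (n + n))              ≤⟨ +-monoʳ-≤ (n * (n * (N * (m * m)))) (*-monoʳ-≤ (m * m) 2n²≤∑zeroOrM) ⟩
    n * (n * (N * (m * m))) + m * m * ∑[ i ∈ allFin n ] zeroOrM i ≤⟨ ∑-wt²-lower ⟩
    ∑[ x ∈ D ] (wt x * wt x)                                      ∎))
    where
    open ≤-Reasoning
    2n²≤∑zeroOrM : n * (n + n) ≤ ∑[ i ∈ allFin n ] zeroOrM i
    2n²≤∑zeroOrM = subst (_≤ ∑[ i ∈ allFin n ] zeroOrM i) (∑-allFin-const n (n + n))
      (∑-mono-≤ (allFin n) (λ {i} _ → 2n≤zeroOrM i))

  plotkin-tight : ∀ {x} → x ∈ D → wt x * wt x + B ≡ 3 * A * wt x + B * 𝟙 (x ≟ᵛ 0ᵛ)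
  plotkin-tight = ∑-squeeze D plotkin-pointwise ∑-plotkin-rhs≤lhs

  ∑zeroOrM≤2n² : ∑[ i ∈ allFin n ] zeroOrM i ≤ n * (n + n)
  ∑zeroOrM≤2n² = *-cancelˡ-≤ m (*-cancelˡ-≤ m (subst₂ _≤_ (*-assoc m m _) (*-assoc m m _)
    (+-cancelˡ-≤ (n * (n * (N * (m * m)))) _ _ (+-cancelʳ-≤ (N * B) _ _ (begin
      n * (n * (N * (m * m))) + m * m * ∑[ i ∈ allFin n ] zeroOrM i + N * B ≤⟨ +-monoˡ-≤ (N * B) ∑-wt²-lower ⟩
      ∑[ x ∈ D ] (wt x * wt x) + N * B                                      ≡⟨ ∑-plotkin-lhs ⟨
      ∑[ x ∈ D ] (wt x * wt x + B)                                          ≤⟨ ∑-mono-≤ D plotkin-pointwise ⟩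
      ∑[ x ∈ D ] (3 * A * wt x + B * 𝟙 (x ≟ᵛ 0ᵛ))                           ≡⟨ ∑-plotkin-rhs ⟩
      n * (n * (N * (m * m))) + m * m * (n * (n + n)) + N * B               ∎)))))
    where open ≤-Reasoning

  wt≡A⊎wt≡2A : ∀ {x} → x ∈ D → x ≢ 0ᵛ → wt x ≡ A ⊎ wt x ≡ A + A
  wt≡A⊎wt≡2A {x} x∈D x≢0 = W²+2A²≡3AW⇒W≡A⊎W≡2A (wt-lower x∈D x≢0)
    (trans (plotkin-tight x∈D) (trans (cong (λ d → 3 * A * wt x + B * d) (𝟙-no (x ≟ᵛ 0ᵛ) x≢0))
      (trans (cong (3 * A * wt x +_) (*-zeroʳ B)) (+-identityʳ _))))

  odd∈every-column : ∀ i → ∃ λ y → y ∈ D × toℕ (lookup y i) % 2 ≡ 1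
  odd∈every-column i with any? (λ y → toℕ (lookup y i) % 2 ≟ 1) D
  ... | yes odd∈ = find odd∈
  ... | no odd∉ = ⊥-elim (<-irrefl refl (begin-strict
    n * (n + n)                                ≡⟨ +-identityʳ _ ⟨
    n * (n + n) + 0                            <⟨ +-monoʳ-< (n * (n + n)) (≤-trans 1≤n (m≤m+n n n)) ⟩
    n * (n + n) + (n + n)                      ≤⟨ subst (λ l → l * (n + n) + (n + n) ≤ ∑[ j ∈ allFin n ] zeroOrM j) (length-allFin n)
                                                    (length*c+d≤∑ zeroOrM (n + n) (n + n) (∈-allFin i) (λ {j} _ → 2n≤zeroOrM j)
                                                      (4n≤zeroOrM-if-even i column-even)) ⟩
    ∑[ j ∈ allFin n ] zeroOrM j                ≤⟨ ∑zeroOrM≤2n² ⟩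
    n * (n + n)                                ∎))
    where
    open ≤-Reasoning
    column-even : ∀ {x} → x ∈ D → toℕ (lookup x i) % 2 ≡ 0
    column-even {x} x∈D with %2≡0⊎%2≡1 (toℕ (lookup x i))
    ... | inj₁ even = even
    ... | inj₂ odd = ⊥-elim (odd∉ (lose x∈D odd))

  ∑-oddCoordinates : ∑ D oddCoordinates + ∑ D oddCoordinates ≡ n * N
  ∑-oddCoordinates = begin
    ∑ D oddCoordinates + ∑ D oddCoordinates                     ≡⟨ cong₂ _+_ by-columns by-columns ⟩
    ∑[ i ∈ allFin n ] oddCount i + ∑[ i ∈ allFin n ] oddCount i ≡⟨ ∑-+ oddCount oddCount (allFin n) ⟨
    ∑[ i ∈ allFin n ] (oddCount i + oddCount i)                 ≡⟨ ∑-cong (allFin n) (λ {i} _ → half i) ⟩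
    ∑[ i ∈ allFin n ] N                                         ≡⟨ ∑-allFin-const n N ⟩
    n * N                                                       ∎
    where
    open ≡-Reasoning
    half : ∀ i → oddCount i + oddCount i ≡ N
    half i = let y , y∈D , yᵢ-odd = odd∈every-column i in oddCount-half y∈D yᵢ-odd
    by-columns : ∑ D oddCoordinates ≡ ∑[ i ∈ allFin n ] oddCount i
    by-columns = ∑-swap (λ x i → toℕ (lookup x i) % 2) D (allFin n)

  oddCoordinates-values : ∀ {x} → x ∈ D →
    oddCoordinates x ≡ 0 ⊎ oddCoordinates x + oddCoordinates x ≡ n ⊎ oddCoordinates x ≡ n
  oddCoordinates-values {x} x∈D with oddCoordinates x ≟ 0
  ... | yes o≡0 = inj₁ o≡0
  ... | no o≢0 = inj₂ (by-weight (wt≡A⊎wt≡2A (·-closed mᶻ x∈D) mx≢0))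
    where
    o : ℕ
    o = oddCoordinates x
    mx≢0 : map (mᶻ ·ᶻ_) x ≢ 0ᵛ
    mx≢0 mx≡0 = o≢0 (m*n≡0⇒m≡0 o q (trans (*-comm o q) (trans (sym (wt-mᶻ· x)) (trans (cong wt mx≡0) (wt-0ᵛ {n})))))
    [o+o]*m≡wt : (o + o) * m ≡ wt (map (mᶻ ·ᶻ_) x)
    [o+o]*m≡wt = trans ([o+o]*m≡2m*o m o) (sym (wt-mᶻ· x))
      where
      [o+o]*m≡2m*o : ∀ m o → (o + o) * m ≡ 2 * m * o
      [o+o]*m≡2m*o = solve-∀
    by-weight : wt (map (mᶻ ·ᶻ_) x) ≡ A ⊎ wt (map (mᶻ ·ᶻ_) x) ≡ A + A → o + o ≡ n ⊎ o ≡ n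
    by-weight (inj₁ wt≡A) = inj₁ (*-cancelʳ-≡ (o + o) n m (trans [o+o]*m≡wt wt≡A))
    by-weight (inj₂ wt≡2A) = inj₂ (m+m≡n+n⇒m≡n (*-cancelʳ-≡ (o + o) (n + n) m
      (trans [o+o]*m≡wt (trans wt≡2A (sym (*-distribʳ-+ m n n))))))

  all-odd∈D : ∃ λ c → c ∈ D × All (λ a → Odd (toℕ a)) c
  all-odd∈D with any? (λ c → all? (λ a → toℕ a % 2 ≟ 1) c) D
  ... | yes all-odd∈ = find all-odd∈
  ... | no all-odd∉ = ⊥-elim (<-irrefl refl (begin-strict
    n * N                                                      ≡⟨ +-identityʳ (n * N) ⟨
    n * N + 0                                                  <⟨ +-monoʳ-< (n * N) 1≤n ⟩
    n * N + n                                                  ≡⟨ cong₂ _+_ ∑-oddCoordinates (trans (cong (n *_) ∑-𝟙-0ᵛ) (*-identityʳ n)) ⟨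
    ∑ D oddCoordinates + ∑ D oddCoordinates + n * ∑[ x ∈ D ] 𝟙 (x ≟ᵛ 0ᵛ)
                                                               ≡⟨ cong₂ _+_ (∑-+ oddCoordinates oddCoordinates D) (∑-*ˡ n _ D) ⟨
    ∑[ x ∈ D ] (oddCoordinates x + oddCoordinates x) + ∑[ x ∈ D ] (n * 𝟙 (x ≟ᵛ 0ᵛ))
                                                               ≡⟨ ∑-+ _ _ D ⟨
    ∑[ x ∈ D ] (oddCoordinates x + oddCoordinates x + n * 𝟙 (x ≟ᵛ 0ᵛ))
                                                               ≤⟨ ∑-mono-≤ D pointwise ⟩
    ∑[ x ∈ D ] n                                               ≡⟨ trans (∑-const n D) (*-comm N n) ⟩
    n * N                                                      ∎))
    where
    open ≤-Reasoning
    pointwise : ∀ {x} → x ∈ D → oddCoordinates x + oddCoordinates x + n * 𝟙 (x ≟ᵛ 0ᵛ) ≤ n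
    pointwise {x} x∈D with x ≟ᵛ 0ᵛ
    ... | yes refl rewrite oddCoordinates-0ᵛ {n} = ≤-reflexive (*-identityʳ n)
    ... | no _ rewrite *-zeroʳ n | +-identityʳ (oddCoordinates x + oddCoordinates x) with oddCoordinates-values x∈D
    ...   | inj₁ o≡0 rewrite o≡0 = z≤n
    ...   | inj₂ (inj₁ o+o≡n) = ≤-reflexive o+o≡n
    ...   | inj₂ (inj₂ o≡n) = ⊥-elim (all-odd∉ (lose x∈D (oddCoordinates≡n⇒all-odd x o≡n)))

lemma6 : (k n : ℕ) → 1 ≤ k → IsPowerOf2 n → (D : Code k n) →
    IsLinear k n D →
    IsCode* k n (n * 2 ^ k) (n * 2 ^ (k ∸ 1)) D →
    ∃ λ c → c ∈ D × All (λ x → Odd (toℕ x)) c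
lemma6 zero _ () _ _ _ _
lemma6 (suc k) n _ (t , n≡2^t) D (0∈D , +-closed , ·-closed) (D-unique , |D|≡n*q , distance) =
  Extremal.all-odd∈D k n D D-unique (+-closed _ _) (λ c → ·-closed c _) 0∈D |D|≡n*q wt-lower 1≤n
  where
  open Residues k using (wt; dist2-from-0)
  wt-lower : ∀ {x} → x ∈ D → x ≢ replicate n (zeroZ (suc k)) → n * 2 ^ k ≤ wt x
  wt-lower {x} x∈D x≢0 = subst (n * 2 ^ k ≤_) (dist2-from-0 x) (distance _ x 0∈D x∈D (x≢0 ∘ sym))
  -- This is the only use of n being a power of 2.
  1≤n : 1 ≤ n
  1≤n = subst (1 ≤_) (sym n≡2^t) (m^n>0 2 t)
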